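{- Let $H=(V,E)$ be a hypergraph and $p\le q$ positive integers. Then $$P(H;p,q,\mathbf{t})=\sum_{S\subseteq V}P(H\times S;p,\mathbf{t})\,(q-p)^{|V|-|S|}.$$
   Context: A hypergraph $H=(V,E)$ has finite vertex set $V$ and finite indexed family $E=(e_i)_{i\in I}$ of subsets of $V$ (parallel edges allowed). For $S\subseteq V$, the vertex section hypergraph $H\times S$ has vertex set $S$ and edges all $e_i$ with $e_i\subseteq S$ (keeping index $i$). A $q$-coloring is $f:V\to\{1,\dots,q\}$; colors $1,\dots,p$ are primary; $e_i$ is primary under $f$ if $f(u)=f(v)\le p$ for all $u,v\in e_i$, and $P(f)$ is the set of indices of primary edges. With indeterminates $t_i$, $P(H;p,q,\mathbf{t})=\sum_{f:V\to[q]}\prod_{i\in P(f)}t_i$, and the multivariate coboundary polynomial is $P(H;p,\mathbf{t})=P(H;p,p,\mathbf{t})$. -}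

module Defs where

open import Level using (Level)
open import Data.Bool using (Bool; true; false; _∧_; _∨_; not; if_then_else_)
open import Data.Nat using (ℕ; zero; suc; _<ᵇ_)
open import Data.Fin using (Fin; toℕ)
open import Data.Fin.Properties using (_≟_)
open import Data.Fin.Subset using (Subset; inside; outside; _⊆_; ⊤)
open import Data.Fin.Subset.Properties using (_⊆?_)
open import Data.Maybe using (Maybe; just; nothing)
open import Data.List using (List; []; _∷_; map; concatMap; foldr; filter; [_])
open import Data.List using () renaming (allFin to allFinL)
open import Data.Vec using (Vec; []; _∷_; lookup)
open import Relation.Nullary using (⌊_⌋)
open import Algebra.Bundles using (CommutativeRing)

record Hypergraph : Set where
  field
    n    : ℕ
    m    : ℕ
    edge : Fin m → Subset n

-- A "partial" hypergraph living inside the ambient vertex set Fin n and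
-- ambient index set Fin m: its vertex set is  verts ⊆ Fin n  and its edge
-- family is (edge i) for those indices i with  idx i = true  (indices kept).
record SubHypergraph (n m : ℕ) : Set where
  field
    verts : Subset n
    idx   : Fin m → Bool
    edge  : Fin m → Subset n

whole : (H : Hypergraph) → SubHypergraph (Hypergraph.n H) (Hypergraph.m H)
whole H = record { verts = ⊤ ; idx = λ _ → true ; edge = Hypergraph.edge H }

_×ˢ_ : (H : Hypergraph) → Subset (Hypergraph.n H) →
       SubHypergraph (Hypergraph.n H) (Hypergraph.m H)
H ×ˢ S = record
  { verts = S
  ; idx   = λ i → ⌊ Hypergraph.edge H i ⊆? S ⌋
  ; edge  = Hypergraph.edge H }

-- A q-coloring of a vertex set S ⊆ Fin n is encoded as a vector
-- c : Vec (Maybe (Fin q)) n with  c[v] = just (f v)  for v ∈ S and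
-- c[v] = nothing for v ∉ S.  Colors are Fin q = {0,…,q-1}; the primary
-- colors are those with toℕ < p (i.e. colors 1..p in the paper's numbering).

colorings : ∀ {n} → Subset n → (q : ℕ) → List (Vec (Maybe (Fin q)) n)
colorings []            q = [ [] ]
colorings (outside ∷ S) q = map (nothing ∷_) (colorings S q)
colorings (inside  ∷ S) q =
  concatMap (λ c → map (just c ∷_) (colorings S q)) (allFinL q)

allV : ∀ {n} → (Fin n → Bool) → Bool
allV {n} P = foldr (λ v b → P v ∧ b) true (allFinL n)

isPrimaryColor : ∀ {q} → (p : ℕ) → Maybe (Fin q) → Bool
isPrimaryColor p (just c) = toℕ c <ᵇ p
isPrimaryColor p nothing  = false

sameColor : ∀ {q} → Maybe (Fin q) → Maybe (Fin q) → Bool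
sameColor (just a) (just b) = ⌊ a ≟ b ⌋
sameColor nothing  nothing  = true
sameColor _        _        = false

primary : ∀ {n q} → (p : ℕ) → Vec (Maybe (Fin q)) n → Subset n → Bool
primary p f e =
  allV (λ u → not (lookup e u) ∨
    (isPrimaryColor p (lookup f u) ∧
     allV (λ v → not (lookup e v) ∨ sameColor (lookup f u) (lookup f v))))

-- Polynomials evaluated in an arbitrary commutative ring R at t : Fin m → R.
-- (An identity for all commutative rings and all t is the same as an
-- identity of polynomials in ℤ[t_i].)

module _ {c ℓ : Level} (R : CommutativeRing c ℓ) where
  open CommutativeRing R

  ΣL : ∀ {A : Set} → List A → (A → Carrier) → Carrier
  ΣL xs g = foldr (λ x acc → g x + acc) 0# xs

  ΠL : ∀ {A : Set} → List A → (A → Carrier) → Carrier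
  ΠL xs g = foldr (λ x acc → g x * acc) 1# xs

  fromℕ : ℕ → Carrier
  fromℕ zero    = 0#
  fromℕ (suc k) = 1# + fromℕ k

  Pol : ∀ {n m} → SubHypergraph n m → (p q : ℕ) → (Fin m → Carrier) → Carrier
  Pol {n} {m} K p q t =
    ΣL (colorings (SubHypergraph.verts K) q) λ f →
      ΠL (filter (λ i → SubHypergraph.idx K i ∧ primary p f (SubHypergraph.edge K i) Data.Bool.≟ true) (allFinL m)) t
    where import Data.Bool

  Cob : ∀ {n m} → SubHypergraph n m → (p : ℕ) → (Fin m → Carrier) → Carrier
  Cob K p t = Pol K p p t

allSubsets : (n : ℕ) → List (Subset n)
allSubsets zero    = [ [] ]
allSubsets (suc n) = map (outside ∷_) (allSubsets n) Data.List.++ map (inside ∷_) (allSubsets n)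
  where import Data.List

-- Recolor each vertex by keepPrimary p: a primary color i < p is kept (as a
-- natural number, which forgets q) and every other color becomes nothing.  An
-- edge is primary exactly when it is monochromatic after recoloring.  Summing
-- a function of the recoloring over the q-colorings of V, vertex by vertex,
-- each vertex gets either one of the p primary colors or one of q - p colors
-- that all recolor to nothing; expanding this product yields a sum over the
-- set S of primary-colored vertices of p-colorings of S, weighted by
-- (q - p)^(|V| - |S|).  For a p-coloring of S a monochromatic edge lies inside
-- S, so it is precisely a primary edge of H × S.
module Submission where

open import Defs
open import Data.Nat using (ℕ; _≤_; _∸_; _^_)
open import Data.Fin using (Fin)
open import Data.Fin.Subset using (∣_∣)
open import Algebra.Bundles using (CommutativeRing)

open import Level using (Level)
open import Function using (_∘_; Equivalence)
open import Data.Bool using (Bool; true; false; _∧_; _∨_; not; if_then_else_)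
import Data.Bool as Bool
open import Data.Bool.Properties using (∧-zeroʳ; T-≡)
open import Data.Nat using (zero; suc; _<_; _<ᵇ_)
import Data.Nat as Nat
open import Data.Nat.Properties using (<⇒<ᵇ; <ᵇ⇒<; ≤⇒≯; m≤m+n; m+[n∸m]≡n; +-∸-assoc)
open import Data.Fin using (toℕ) renaming (zero to fzero; suc to fsuc)
import Data.Fin as Fin
open import Data.Fin.Properties using (toℕ-injective)
open import Data.Fin.Subset using (Subset; inside; outside; _⊆_; ⊤)
open import Data.Fin.Subset.Properties using (_⊆?_; ∣p∣≤n)
open import Data.Maybe using (Maybe; just; nothing; is-just)
open import Data.List using (List; []; _∷_; map; concatMap; foldr; filter; _++_; tabulate)
open import Data.List using () renaming (allFin to allFinL)
open import Data.List.Properties using (foldr-cong; foldr-map)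
open import Data.List.Relation.Unary.All using (All; []; _∷_; universal)
import Data.List.Relation.Unary.All as All
open import Data.List.Relation.Unary.All.Properties using (map⁺; concat⁺)
open import Data.List.Membership.Propositional using (_∈_)
open import Data.List.Membership.Propositional.Properties using (∈-allFin)
open import Data.List.Relation.Unary.Any using (here; there)
open import Data.Vec using (Vec; []; _∷_; lookup)
import Data.Vec as Vec
open import Data.Vec.Properties using (lookup-map; []=⇒lookup; lookup⇒[]=)
open import Relation.Nullary using (⌊_⌋; yes; no; contradiction)
open import Relation.Nullary.Decidable using (isYes≗does; dec-true)
open import Relation.Binary.PropositionalEquality
  using (_≡_; _≢_; refl; sym; trans; cong; cong₂)

∧-elimˡ : ∀ {a b} → a ∧ b ≡ true → a ≡ true
∧-elimˡ {true}  _ = refl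
∧-elimˡ {false} h = h

∧-elimʳ : ∀ {a b} → a ∧ b ≡ true → b ≡ true
∧-elimʳ {true} h = h

∧-redundantˡ : ∀ {a} b → (b ≡ true → a ≡ true) → a ∧ b ≡ b
∧-redundantˡ false _   = ∧-zeroʳ _
∧-redundantˡ true  b⇒a rewrite b⇒a refl = refl

allV-cong : ∀ {n} {P Q : Fin n → Bool} → (∀ v → P v ≡ Q v) → allV P ≡ allV Q
allV-cong {n} P≗Q = foldr-cong (λ v b → cong (_∧ b) (P≗Q v)) refl (allFinL n)

allV-elim : ∀ {n} {P : Fin n → Bool} → allV P ≡ true → ∀ u → P u ≡ true
allV-elim {n} {P} allP u = go (allFinL n) allP (∈-allFin u)
  where
  go : ∀ xs → foldr (λ v b → P v ∧ b) true xs ≡ true → u ∈ xs → P u ≡ true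
  go (x ∷ xs) h (here refl)  = ∧-elimˡ h
  go (x ∷ xs) h (there u∈xs) = go xs (∧-elimʳ {P x} h) u∈xs

filter-true-cong : ∀ {A : Set} {a b : A → Bool} → (∀ x → a x ≡ b x) → (xs : List A) →
  filter (λ x → a x Bool.≟ true) xs ≡ filter (λ x → b x Bool.≟ true) xs
filter-true-cong a≗b []       = refl
filter-true-cong {b = b} a≗b (x ∷ xs) rewrite a≗b x with b x Bool.≟ true
... | yes _ = cong (x ∷_) (filter-true-cong a≗b xs)
... | no _  = filter-true-cong a≗b xs

keepPrimaryℕ : ℕ → ℕ → Maybe ℕ
keepPrimaryℕ p i = if i <ᵇ p then just i else nothing

keepPrimary : ∀ {q} → ℕ → Maybe (Fin q) → Maybe ℕ
keepPrimary p (just c) = keepPrimaryℕ p (toℕ c)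
keepPrimary p nothing  = nothing

keepPrimaryℕ-< : ∀ {p i} → i < p → keepPrimaryℕ p i ≡ just i
keepPrimaryℕ-< i<p rewrite Equivalence.to T-≡ (<⇒<ᵇ i<p) = refl

keepPrimaryℕ-≥ : ∀ {p i} → p ≤ i → keepPrimaryℕ p i ≡ nothing
keepPrimaryℕ-≥ {p} {i} p≤i with i <ᵇ p in i<ᵇp
... | false = refl
... | true  = contradiction (<ᵇ⇒< i p (Equivalence.from T-≡ i<ᵇp)) (≤⇒≯ p≤i)

sameJust : Maybe ℕ → Maybe ℕ → Bool
sameJust (just i) (just j) = ⌊ i Nat.≟ j ⌋
sameJust _        _        = false

monochromatic : ∀ {n} → Vec (Maybe ℕ) n → Subset n → Bool
monochromatic w e =
  allV (λ u → not (lookup e u) ∨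
    (is-just (lookup w u) ∧
     allV (λ v → not (lookup e v) ∨ sameJust (lookup w u) (lookup w v))))

sameColor≡sameJust : ∀ {q} p {a : Fin q} → (toℕ a <ᵇ p) ≡ true → ∀ y →
  sameColor (just a) y ≡ sameJust (just (toℕ a)) (keepPrimary p y)
sameColor≡sameJust p a<p nothing = refl
sameColor≡sameJust p {a} a<p (just b) with toℕ b <ᵇ p in b<p
... | true with a Fin.≟ b | toℕ a Nat.≟ toℕ b
...   | yes _   | yes _   = refl
...   | no _    | no _    = refl
...   | yes a≡b | no a≢b  = contradiction (cong toℕ a≡b) a≢b
...   | no a≢b  | yes a≡b = contradiction (toℕ-injective a≡b) a≢b
sameColor≡sameJust p {a} a<p (just b) | false with a Fin.≟ b
... | no _     = refl
... | yes refl = contradiction (trans (sym a<p) b<p) λ ()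

primary≡monochromatic : ∀ {n q} p (f : Vec (Maybe (Fin q)) n) e →
  primary p f e ≡ monochromatic (Vec.map (keepPrimary p) f) e
primary≡monochromatic p f e = allV-cong λ u →
  cong (not (lookup e u) ∨_)
    (trans (atVertex (lookup f u))
      (cong (λ x → is-just x ∧ allV (λ v → not (lookup e v) ∨ sameJust x (lookup w v)))
        (sym (lookup-map u (keepPrimary p) f))))
  where
  w = Vec.map (keepPrimary p) f
  atVertex : ∀ x →
    (isPrimaryColor p x ∧ allV (λ v → not (lookup e v) ∨ sameColor x (lookup f v))) ≡
    (is-just (keepPrimary p x) ∧ allV (λ v → not (lookup e v) ∨ sameJust (keepPrimary p x) (lookup w v)))
  atVertex nothing = refl
  atVertex (just a) with toℕ a <ᵇ p in a<p
  ... | false = refl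
  ... | true  = allV-cong λ v →
    cong (not (lookup e v) ∨_)
      (trans (sameColor≡sameJust p a<p (lookup f v))
        (cong (sameJust (just (toℕ a))) (sym (lookup-map v (keepPrimary p) f))))

UncoloredOutside : ∀ {n q} → Subset n → Vec (Maybe (Fin q)) n → Set
UncoloredOutside S g = ∀ u → lookup S u ≡ outside → lookup g u ≡ nothing

colorings-uncoloredOutside : ∀ {n} (S : Subset n) q → All (UncoloredOutside S) (colorings S q)
colorings-uncoloredOutside []            q = (λ ()) ∷ []
colorings-uncoloredOutside (outside ∷ S) q = map⁺ (All.map extend (colorings-uncoloredOutside S q))
  where
  extend : ∀ {g} → UncoloredOutside S g → UncoloredOutside (outside ∷ S) (nothing ∷ g)
  extend unc fzero    _  = refl
  extend unc (fsuc u) Su = unc u Su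
colorings-uncoloredOutside (inside ∷ S) q =
  concat⁺ (map⁺ (universal (λ c → map⁺ (All.map (extend c) (colorings-uncoloredOutside S q)))
                            (allFinL q)))
  where
  extend : ∀ c {g} → UncoloredOutside S g → UncoloredOutside (inside ∷ S) (just c ∷ g)
  extend c unc (fsuc u) Su = unc u Su

monochromatic-colored : ∀ {n} (w : Vec (Maybe ℕ) n) e → monochromatic w e ≡ true →
  ∀ {u} → lookup e u ≡ true → is-just (lookup w u) ≡ true
monochromatic-colored w e mono {u} u∈e with lookup e u | allV-elim mono u
... | true | h = ∧-elimˡ h

monochromatic⇒⊆ : ∀ {n q} p {S : Subset n} {g : Vec (Maybe (Fin q)) n} {e} → UncoloredOutside S g →
  monochromatic (Vec.map (keepPrimary p) g) e ≡ true → e ⊆ S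
monochromatic⇒⊆ p {S} {g} {e} unc mono {u} u∈e with lookup S u in Su
... | inside  = lookup⇒[]= u S Su
... | outside =
  contradiction (monochromatic-colored (Vec.map (keepPrimary p) g) e mono ([]=⇒lookup u∈e)) uncolored
  where
  uncolored : is-just (lookup (Vec.map (keepPrimary p) g) u) ≢ true
  uncolored rewrite lookup-map u (keepPrimary p) g | unc u Su = λ ()

section-primary≡monochromatic : ∀ {n q} p {S : Subset n} {g : Vec (Maybe (Fin q)) n} →
  UncoloredOutside S g → ∀ e →
  (⌊ e ⊆? S ⌋ ∧ primary p g e) ≡ monochromatic (Vec.map (keepPrimary p) g) e
section-primary≡monochromatic p {S} {g} unc e
  rewrite primary≡monochromatic p g e =
    ∧-redundantˡ _ λ mono →
      trans (isYes≗does (e ⊆? S)) (dec-true (e ⊆? S) (monochromatic⇒⊆ p {g = g} unc mono))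

module Sums {c ℓ : Level} (R : CommutativeRing c ℓ) where
  open CommutativeRing R renaming (refl to ≈-refl; sym to ≈-sym; trans to ≈-trans)
  open import Algebra.Properties.CommutativeSemigroup +-commutativeSemigroup using (interchange)
  open import Algebra.Properties.Semiring.Mult semiring using (_×_; ×1-homo-*)

  Σ : ∀ {A : Set} → List A → (A → Carrier) → Carrier
  Σ = ΣL R

  Σ-map : ∀ {A B : Set} (h : A → B) (xs : List A) (g : B → Carrier) → Σ (map h xs) g ≡ Σ xs (g ∘ h)
  Σ-map h xs g = foldr-map _ h 0# xs

  Σ-cong-All : ∀ {A : Set} {F G : A → Carrier} {xs : List A} →
    All (λ x → F x ≈ G x) xs → Σ xs F ≈ Σ xs G
  Σ-cong-All []         = ≈-refl
  Σ-cong-All (Fx≈Gx ∷ h) = +-cong Fx≈Gx (Σ-cong-All h)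

  Σ-cong : ∀ {A : Set} {F G : A → Carrier} → (∀ x → F x ≈ G x) → (xs : List A) → Σ xs F ≈ Σ xs G
  Σ-cong F≈G xs = Σ-cong-All (universal F≈G xs)

  Σ-zero : ∀ {A : Set} (xs : List A) → Σ xs (λ _ → 0#) ≈ 0#
  Σ-zero []       = ≈-refl
  Σ-zero (x ∷ xs) = ≈-trans (+-identityˡ _) (Σ-zero xs)

  Σ-++ : ∀ {A : Set} (xs ys : List A) (g : A → Carrier) → Σ (xs ++ ys) g ≈ Σ xs g + Σ ys g
  Σ-++ []       ys g = ≈-sym (+-identityˡ _)
  Σ-++ (x ∷ xs) ys g = ≈-trans (+-congˡ (Σ-++ xs ys g)) (≈-sym (+-assoc _ _ _))

  Σ-concatMap : ∀ {A B : Set} (f : A → List B) (xs : List A) (g : B → Carrier) →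
    Σ (concatMap f xs) g ≈ Σ xs (λ x → Σ (f x) g)
  Σ-concatMap f []       g = ≈-refl
  Σ-concatMap f (x ∷ xs) g = ≈-trans (Σ-++ (f x) (concatMap f xs) g) (+-congˡ (Σ-concatMap f xs g))

  Σ-+ : ∀ {A : Set} (xs : List A) (F G : A → Carrier) → Σ xs (λ x → F x + G x) ≈ Σ xs F + Σ xs G
  Σ-+ []       F G = ≈-sym (+-identityˡ _)
  Σ-+ (x ∷ xs) F G = ≈-trans (+-congˡ (Σ-+ xs F G)) (interchange _ _ _ _)

  Σ-*ʳ : ∀ {A : Set} (xs : List A) (F : A → Carrier) k → Σ xs (λ x → F x * k) ≈ Σ xs F * k
  Σ-*ʳ []       F k = ≈-sym (zeroˡ k)
  Σ-*ʳ (x ∷ xs) F k = ≈-trans (+-congˡ (Σ-*ʳ xs F k)) (≈-sym (distribʳ k _ _))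

  Σ-swap : ∀ {A B : Set} (xs : List A) (ys : List B) (F : A → B → Carrier) →
    Σ xs (λ x → Σ ys (F x)) ≈ Σ ys (λ y → Σ xs (λ x → F x y))
  Σ-swap []       ys F = ≈-sym (Σ-zero ys)
  Σ-swap (x ∷ xs) ys F = ≈-trans (+-congˡ (Σ-swap xs ys F)) (≈-sym (Σ-+ ys (F x) _))

  sumTo : ℕ → (ℕ → Carrier) → Carrier
  sumTo zero    F = 0#
  sumTo (suc k) F = F 0 + sumTo k (F ∘ suc)

  Σ-tabulate : ∀ {A : Set} q {f : Fin q → A} {g : A → Carrier} (F : ℕ → Carrier) →
    (∀ i → g (f i) ≡ F (toℕ i)) → Σ (tabulate f) g ≡ sumTo q F
  Σ-tabulate zero    F gf≗F = refl
  Σ-tabulate (suc q) F gf≗F = cong₂ _+_ (gf≗F fzero) (Σ-tabulate q (F ∘ suc) (gf≗F ∘ fsuc))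

  Σ-allFin : ∀ q (F : ℕ → Carrier) → Σ (allFinL q) (F ∘ toℕ) ≡ sumTo q F
  Σ-allFin q F = Σ-tabulate q F (λ _ → refl)

  sumTo-cong : ∀ k {F G : ℕ → Carrier} → (∀ i → i < k → F i ≈ G i) → sumTo k F ≈ sumTo k G
  sumTo-cong zero    F≈G = ≈-refl
  sumTo-cong (suc k) F≈G =
    +-cong (F≈G 0 (Nat.s≤s Nat.z≤n)) (sumTo-cong k (λ i i<k → F≈G (suc i) (Nat.s≤s i<k)))

  sumTo-+ : ∀ a b (F : ℕ → Carrier) → sumTo (a Nat.+ b) F ≈ sumTo a F + sumTo b (λ i → F (a Nat.+ i))
  sumTo-+ zero    b F = ≈-sym (+-identityˡ _)
  sumTo-+ (suc a) b F = ≈-trans (+-congˡ (sumTo-+ a b (F ∘ suc))) (≈-sym (+-assoc _ _ _))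

  sumTo-const : ∀ k x → sumTo k (λ _ → x) ≈ fromℕ R k * x
  sumTo-const zero    x = ≈-sym (zeroˡ x)
  sumTo-const (suc k) x =
    ≈-trans (+-cong (≈-sym (*-identityˡ x)) (sumTo-const k x)) (≈-sym (distribʳ x _ _))

  Σ-allSubsets-suc : ∀ n (F : Subset (suc n) → Carrier) →
    Σ (allSubsets (suc n)) F ≈ Σ (allSubsets n) (F ∘ (outside ∷_)) + Σ (allSubsets n) (F ∘ (inside ∷_))
  Σ-allSubsets-suc n F = ≈-trans (Σ-++ (map (outside ∷_) (allSubsets n)) _ F)
    (reflexive (cong₂ _+_ (Σ-map (outside ∷_) (allSubsets n) F) (Σ-map (inside ∷_) (allSubsets n) F)))

  fromℕ≡×1 : ∀ k → fromℕ R k ≡ k × 1#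
  fromℕ≡×1 zero    = refl
  fromℕ≡×1 (suc k) = cong (1# +_) (fromℕ≡×1 k)

  fromℕ-* : ∀ a b → fromℕ R (a Nat.* b) ≈ fromℕ R a * fromℕ R b
  fromℕ-* a b rewrite fromℕ≡×1 (a Nat.* b) | fromℕ≡×1 a | fromℕ≡×1 b = ×1-homo-* a b

module Expansion {c ℓ : Level} (R : CommutativeRing c ℓ) (p q : ℕ) (p≤q : p ≤ q) where
  open CommutativeRing R renaming (refl to ≈-refl; sym to ≈-sym; trans to ≈-trans)
  open import Relation.Binary.Reasoning.Setoid setoid
  open import Algebra.Properties.CommutativeSemigroup *-commutativeSemigroup using (xy∙z≈y∙xz)
  open Sums R

  coloringSum : ∀ {n} → Subset n → ℕ → (Vec (Maybe ℕ) n → Carrier) → Carrier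
  coloringSum S r W = Σ (colorings S r) (W ∘ Vec.map (keepPrimary p))

  weight : ∀ {n} → Subset n → Carrier
  weight {n} S = fromℕ R ((q ∸ p) ^ (n ∸ ∣ S ∣))

  weight-outside : ∀ {n} (S : Subset n) → weight (outside ∷ S) ≈ fromℕ R (q ∸ p) * weight S
  weight-outside {n} S rewrite +-∸-assoc 1 (∣p∣≤n S) = fromℕ-* (q ∸ p) _

  coloringSum-outside : ∀ {n} (S : Subset n) r W →
    coloringSum (outside ∷ S) r W ≡ coloringSum S r (W ∘ (nothing ∷_))
  coloringSum-outside S r W = Σ-map (nothing ∷_) (colorings S r) _

  coloringSum-inside : ∀ {n} (S : Subset n) r W →
    coloringSum (inside ∷ S) r W ≈
    Σ (allFinL r) (λ c → coloringSum S r (W ∘ (keepPrimary p (just c) ∷_)))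
  coloringSum-inside S r W =
    ≈-trans (Σ-concatMap _ (allFinL r) _)
            (Σ-cong (λ c → reflexive (Σ-map (just c ∷_) (colorings S r) _)) (allFinL r))

  sumTo-p-keepPrimaryℕ : (G : Maybe ℕ → Carrier) → sumTo p (G ∘ keepPrimaryℕ p) ≈ sumTo p (G ∘ just)
  sumTo-p-keepPrimaryℕ G = sumTo-cong p (λ i i<p → reflexive (cong G (keepPrimaryℕ-< i<p)))

  sumTo-q-keepPrimaryℕ : (G : Maybe ℕ → Carrier) →
    sumTo q (G ∘ keepPrimaryℕ p) ≈ sumTo p (G ∘ just) + fromℕ R (q ∸ p) * G nothing
  sumTo-q-keepPrimaryℕ G = begin
    sumTo q (G ∘ keepPrimaryℕ p)
      ≡⟨ cong (λ k → sumTo k (G ∘ keepPrimaryℕ p)) (sym (m+[n∸m]≡n p≤q)) ⟩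
    sumTo (p Nat.+ (q ∸ p)) (G ∘ keepPrimaryℕ p)
      ≈⟨ sumTo-+ p (q ∸ p) _ ⟩
    sumTo p (G ∘ keepPrimaryℕ p) + sumTo (q ∸ p) (λ i → G (keepPrimaryℕ p (p Nat.+ i)))
      ≈⟨ +-cong (sumTo-p-keepPrimaryℕ G)
                (sumTo-cong (q ∸ p) λ i _ → reflexive (cong G (keepPrimaryℕ-≥ (m≤m+n p i)))) ⟩
    sumTo p (G ∘ just) + sumTo (q ∸ p) (λ _ → G nothing)
      ≈⟨ +-congˡ (sumTo-const (q ∸ p) (G nothing)) ⟩
    sumTo p (G ∘ just) + fromℕ R (q ∸ p) * G nothing ∎

  coloringSum-inside-p : ∀ {n} (S : Subset n) W →
    coloringSum (inside ∷ S) p W ≈ sumTo p (λ i → coloringSum S p (W ∘ (just i ∷_)))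
  coloringSum-inside-p S W = begin
    coloringSum (inside ∷ S) p W
      ≈⟨ coloringSum-inside S p W ⟩
    Σ (allFinL p) (λ c → coloringSum S p (W ∘ (keepPrimary p (just c) ∷_)))
      ≡⟨ Σ-allFin p _ ⟩
    sumTo p (λ i → coloringSum S p (W ∘ (keepPrimaryℕ p i ∷_)))
      ≈⟨ sumTo-p-keepPrimaryℕ (λ m → coloringSum S p (W ∘ (m ∷_))) ⟩
    sumTo p (λ i → coloringSum S p (W ∘ (just i ∷_))) ∎

  coloringSum-expansion : ∀ n (W : Vec (Maybe ℕ) n → Carrier) →
    coloringSum ⊤ q W ≈ Σ (allSubsets n) (λ S → coloringSum S p W * weight S)
  coloringSum-expansion zero    W = ≈-sym (begin
    (W [] + 0#) * (1# + 0#) + 0# ≈⟨ +-identityʳ _ ⟩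
    (W [] + 0#) * (1# + 0#)      ≈⟨ *-congˡ (+-identityʳ 1#) ⟩
    (W [] + 0#) * 1#             ≈⟨ *-identityʳ _ ⟩
    W [] + 0#                    ∎)
  coloringSum-expansion (suc n) W = begin
    coloringSum ⊤ q W
      ≈⟨ coloringSum-inside ⊤ q W ⟩
    Σ (allFinL q) (λ c → coloringSum ⊤ q (W ∘ (κ c ∷_)))
      ≈⟨ Σ-cong (λ c → coloringSum-expansion n (W ∘ (κ c ∷_))) (allFinL q) ⟩
    Σ (allFinL q) (λ c → Σ L (λ S → Y S (κ c) * weight S))
      ≈⟨ Σ-swap (allFinL q) L _ ⟩
    Σ L (λ S → Σ (allFinL q) (λ c → Y S (κ c) * weight S))
      ≈⟨ Σ-cong splitFirstVertex L ⟩
    Σ L (λ S → Z (inside ∷ S) + Z (outside ∷ S))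
      ≈⟨ Σ-+ L _ _ ⟩
    Σ L (Z ∘ (inside ∷_)) + Σ L (Z ∘ (outside ∷_))
      ≈⟨ +-comm _ _ ⟩
    Σ L (Z ∘ (outside ∷_)) + Σ L (Z ∘ (inside ∷_))
      ≈⟨ ≈-sym (Σ-allSubsets-suc n Z) ⟩
    Σ (allSubsets (suc n)) Z ∎
    where
    L = allSubsets n
    κ : Fin q → Maybe ℕ
    κ c = keepPrimary p (just c)
    Y : Subset n → Maybe ℕ → Carrier
    Y S m = coloringSum S p (W ∘ (m ∷_))
    Z : Subset (suc n) → Carrier
    Z S = coloringSum S p W * weight S
    splitFirstVertex : ∀ S →
      Σ (allFinL q) (λ c → Y S (κ c) * weight S) ≈ Z (inside ∷ S) + Z (outside ∷ S)
    splitFirstVertex S = begin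
      Σ (allFinL q) (λ c → Y S (κ c) * weight S)
        ≈⟨ Σ-*ʳ (allFinL q) _ _ ⟩
      Σ (allFinL q) (Y S ∘ κ) * weight S
        ≡⟨ cong (_* weight S) (Σ-allFin q _) ⟩
      sumTo q (Y S ∘ keepPrimaryℕ p) * weight S
        ≈⟨ *-congʳ (sumTo-q-keepPrimaryℕ (Y S)) ⟩
      (sumTo p (Y S ∘ just) + fromℕ R (q ∸ p) * Y S nothing) * weight S
        ≈⟨ distribʳ _ _ _ ⟩
      sumTo p (Y S ∘ just) * weight S + (fromℕ R (q ∸ p) * Y S nothing) * weight S
        ≈⟨ +-cong (*-congʳ (≈-sym (coloringSum-inside-p S W))) (xy∙z≈y∙xz _ _ _) ⟩
      Z (inside ∷ S) + Y S nothing * (fromℕ R (q ∸ p) * weight S)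
        ≈⟨ +-congˡ (*-cong (reflexive (sym (coloringSum-outside S p W))) (≈-sym (weight-outside S))) ⟩
      Z (inside ∷ S) + Z (outside ∷ S) ∎

mainTheorem4 : ∀ {c ℓ} (R : CommutativeRing c ℓ) (H : Hypergraph) (p q : ℕ) →
    1 ≤ p → p ≤ q →
    (t : Fin (Hypergraph.m H) → CommutativeRing.Carrier R) →
    CommutativeRing._≈_ R
      (Pol R (whole H) p q t)
      (ΣL R (allSubsets (Hypergraph.n H)) (λ S →
        CommutativeRing._*_ R (Cob R (H ×ˢ S) p t)
          (fromℕ R ((q ∸ p) ^ (Hypergraph.n H ∸ ∣ S ∣)))))
-- The identity holds for p = 0 as well.
mainTheorem4 R H p q _ p≤q t = begin
  Pol R (whole H) p q t
    ≈⟨ Σ-cong (λ f → reflexive (monomial-cong (primary≡monochromatic p f ∘ edge))) (colorings ⊤ q) ⟩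
  coloringSum ⊤ q monochromaticMonomial
    ≈⟨ coloringSum-expansion n monochromaticMonomial ⟩
  Σ (allSubsets n) (λ S → coloringSum S p monochromaticMonomial * weight S)
    ≈⟨ Σ-cong (λ S → *-congʳ (Σ-cong-All (All.map
         (λ {g} unc → reflexive (monomial-cong (sym ∘ section-primary≡monochromatic p {g = g} unc ∘ edge)))
         (colorings-uncoloredOutside S p)))) (allSubsets n) ⟩
  Σ (allSubsets n) (λ S → Cob R (H ×ˢ S) p t * weight S) ∎
  where
  open Hypergraph H
  open CommutativeRing R using (Carrier; _*_; setoid; reflexive; *-congʳ)
  open import Relation.Binary.Reasoning.Setoid setoid
  open Sums R
  open Expansion R p q p≤q

  monomial-cong : ∀ {a b : Fin m → Bool} → (∀ i → a i ≡ b i) →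
    ΠL R (filter (λ i → a i Bool.≟ true) (allFinL m)) t ≡
    ΠL R (filter (λ i → b i Bool.≟ true) (allFinL m)) t
  monomial-cong a≗b = cong (λ is → ΠL R is t) (filter-true-cong a≗b (allFinL m))

  monochromaticMonomial : Vec (Maybe ℕ) n → Carrier
  monochromaticMonomial w = ΠL R (filter (λ i → monochromatic w (edge i) Bool.≟ true) (allFinL m)) t
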